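{- Let $G=(\mathcal{X},\Sigma,\delta)$ be a context-free grammar, let $\Sigma'=\Sigma\cup\{v_X\mid X\in\mathcal{X}\}$ where the $v_X$ are fresh symbols, let $\mathbf{F}$ be the polynomial transformation of $G$ over the language semiring on $\Sigma'$, let $\mathbf{v}$ be the valuation mapping each $X\in\mathcal{X}$ to $\{v_X\}$, and let $\tilde G=(\mathcal{X},\Sigma',\tilde\delta)$ be the linear grammar defined below. Then $L(\tilde G)=(D\mathbf{F}|_{\mathbf{v}})^*(\mathbf{F}(\mathbf{v}))$, i.e. for every $X\in\mathcal{X}$, $L_X(\tilde G)=\bigl((D\mathbf{F}|_{\mathbf{v}})^*(\mathbf{F}(\mathbf{v}))\bigr)(X)$.
   Context: For a context-free grammar $G=(\mathcal{X},\Sigma,\delta)$ (variables $\mathcal{X}$, terminals $\Sigma$, productions $\delta\subseteq\mathcal{X}\times(\Sigma\cup\mathcal{X})^*$), $L_X(G)=\{w\in\Sigma^*\mid X\Rightarrow^*w\}$ and $L(G)$ is the valuation $X\mapsto L_X(G)$. The language semiring over an alphabet $\Sigma'$ is $\langle2^{\Sigma'^*},\cup,\cdot,\emptyset,\{\varepsilon\}\rangle$. The polynomial transformation of $G$ is $\mathbf{F}=(\mathbf{F}_X)_{X\in\mathcal{X}}$ with $\mathbf{F}_X=\bigcup_{(X,\alpha)\in\delta}\alpha$, where each $\alpha\in(\Sigma\cup\mathcal{X})^*$ is read as a monomial (terminals as singleton languages, concatenation as product); valuations $\mathbf{u}$ map $\mathcal{X}$ to languages and $\mathbf{F}(\mathbf{u})(X)=\mathbf{F}_X(\mathbf{u})$.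 Differential: for a polynomial $f$, $D_Xf|_{\mathbf{u}}(\mathbf{w})$ is $\emptyset$ if $f$ is a constant language or a variable other than $X$, $\mathbf{w}(X)$ if $f=X$, $D_Xg|_{\mathbf{u}}(\mathbf{w})\cdot h(\mathbf{u})\cup g(\mathbf{u})\cdot D_Xh|_{\mathbf{u}}(\mathbf{w})$ if $f=g\cdot h$, $D_Xg|_{\mathbf{u}}(\mathbf{w})\cup D_Xh|_{\mathbf{u}}(\mathbf{w})$ if $f=g\cup h$; $Df|_{\mathbf{u}}=\bigcup_XD_Xf|_{\mathbf{u}}$, $D\mathbf{F}|_{\mathbf{u}}(\mathbf{w})(X)=D\mathbf{F}_X|_{\mathbf{u}}(\mathbf{w})$, and $H^*(\mathbf{w})=\bigcup_{j\ge0}H^j(\mathbf{w})$ pointwise. The linear grammar $\tilde G=(\mathcal{X},\Sigma',\tilde\delta)$: for a word $\beta\in(\Sigma\cup\mathcal{X})^*$ let $\hat\beta\in\Sigma'^*$ be $\beta$ with every variable $Z$ replaced by $v_Z$. For every production $(X,\alpha)\in\delta$, $\tilde\delta$ contains $X\rightarrow\hat\alpha$, and for every factorization $\alpha=\beta Y\beta'$ with $Y\in\mathcal{X}$, $\tilde\delta$ contains $X\rightarrow\hat\beta\,Y\,\hat\beta'$. (Equivalently, writing $D\mathbf{F}_X|_{\mathbf{v}}$ as a union of monomials $a_i\cdot\mathrm{d}X_i\cdot a_i'$ and $\mathbf{F}_X$ as a union of monomials $m_j$, $\tilde\delta$ has $X\to a_iX_ia_i'$ and $X\to m_j(\mathbf{v})$.)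 -}

module Defs where

open import Data.Nat using (ℕ; zero; suc)
open import Data.Fin using (Fin; _≟_)
open import Data.List using (List; []; _∷_; _++_; map; foldr; concatMap)
open import Data.List.Membership.Propositional using (_∈_)
open import Data.Product using (Σ; ∃; _×_; _,_)
open import Data.Sum using (_⊎_; inj₁; inj₂)
open import Data.Empty using (⊥)
open import Data.Bool using (if_then_else_)
open import Relation.Nullary using (does)
open import Relation.Binary.PropositionalEquality using (_≡_)
open import Relation.Binary.Construct.Closure.ReflexiveTransitive using (Star)

Language : Set → Set₁
Language A = List A → Set

∅L : ∀ {A : Set} → Language A
∅L _ = ⊥

εL : ∀ {A : Set} → Language A
εL w = w ≡ []

⟦_⟧ : ∀ {A : Set} → A → Language A
⟦ a ⟧ w = w ≡ a ∷ []

_∪L_ : ∀ {A : Set} → Language A → Language A → Language A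
(K ∪L K') w = K w ⊎ K' w

_·L_ : ∀ {A : Set} → Language A → Language A → Language A
(K ·L K') w = ∃ λ u → ∃ λ u' → (w ≡ u ++ u') × K u × K' u'

Valuation : Set → ℕ → Set₁
Valuation A n = Fin n → Language A

data Poly (A : Set) (n : ℕ) : Set₁ where
  const : Language A → Poly A n
  var   : Fin n → Poly A n
  _⊗_   : Poly A n → Poly A n → Poly A n
  _⊕_   : Poly A n → Poly A n → Poly A n

evalP : ∀ {A : Set} {n : ℕ} → Poly A n → Valuation A n → Language A
evalP (const K) u = K
evalP (var Y)   u = u Y
evalP (g ⊗ h)   u = evalP g u ·L evalP h u
evalP (g ⊕ h)   u = evalP g u ∪L evalP h u

DX : ∀ {A : Set} {n : ℕ} → Fin n → Poly A n → Valuation A n → Valuation A n → Language A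
DX X (const K) u w = ∅L
DX X (var Y)   u w = if does (X ≟ Y) then w X else ∅L
DX X (g ⊗ h)   u w = (DX X g u w ·L evalP h u) ∪L (evalP g u ·L DX X h u w)
DX X (g ⊕ h)   u w = DX X g u w ∪L DX X h u w

Dpoly : ∀ {A : Set} {n : ℕ} → Poly A n → Valuation A n → Valuation A n → Language A
Dpoly f u w s = Σ (Fin _) λ X → DX X f u w s

iter : ∀ {A : Set} {n : ℕ} → (Valuation A n → Valuation A n) → ℕ → Valuation A n → Valuation A n
iter H zero    w = w
iter H (suc j) w = H (iter H j w)

star : ∀ {A : Set} {n : ℕ} → (Valuation A n → Valuation A n) → Valuation A n → Valuation A n
star H w X s = Σ ℕ λ j → iter H j w X s

record CFG (n : ℕ) (Σ' : Set) : Set where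
  field
    productions : List (Fin n × List (Σ' ⊎ Fin n))
open CFG public

data Step {n : ℕ} {T : Set} (G : CFG n T) : List (T ⊎ Fin n) → List (T ⊎ Fin n) → Set where
  step : ∀ (β β' : List (T ⊎ Fin n)) (X : Fin n) (α : List (T ⊎ Fin n)) →
         (X , α) ∈ productions G →
         Step G (β ++ inj₂ X ∷ β') (β ++ α ++ β')

Lang : ∀ {n T} → CFG n T → Fin n → Language T
Lang G X w = Star (Step G) (inj₂ X ∷ []) (map inj₁ w)

-- Σ' = Σ ∪ {v_X | X ∈ 𝒳}, v_X represented as inj₂ X

Σ′ : Set → ℕ → Set
Σ′ T n = T ⊎ Fin n

mono : ∀ {T : Set} {n : ℕ} → List (T ⊎ Fin n) → Poly (Σ′ T n) n
mono []             = const εL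
mono (inj₁ a ∷ α)   = const ⟦ inj₁ a ⟧ ⊗ mono α
mono (inj₂ Z ∷ α)   = var Z ⊗ mono α

Fpoly : ∀ {T : Set} {n : ℕ} → CFG n T → Fin n → Poly (Σ′ T n) n
Fpoly G X = foldr (λ { (Y , α) r → if does (Y ≟ X) then (mono α ⊕ r) else r })
                  (const ∅L) (productions G)

Fval : ∀ {T : Set} {n : ℕ} → CFG n T → Valuation (Σ′ T n) n → Valuation (Σ′ T n) n
Fval G u X = evalP (Fpoly G X) u

DF : ∀ {T : Set} {n : ℕ} → CFG n T → Valuation (Σ′ T n) n → Valuation (Σ′ T n) n → Valuation (Σ′ T n) n
DF G u w X = Dpoly (Fpoly G X) u w

vval : ∀ {T : Set} {n : ℕ} → Valuation (Σ′ T n) n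
vval X = ⟦ inj₂ X ⟧

-- β̂ : replace each variable Z by the terminal v_Z
hat : ∀ {T : Set} {n : ℕ} → List (T ⊎ Fin n) → List (Σ′ T n ⊎ Fin n)
hat = map inj₁

factorizations : ∀ {T : Set} {n : ℕ} → List (T ⊎ Fin n) → List (List (T ⊎ Fin n) × Fin n × List (T ⊎ Fin n))
factorizations [] = []
factorizations (inj₁ a ∷ α) = map (λ { (β , Y , β') → (inj₁ a ∷ β , Y , β') }) (factorizations α)
factorizations (inj₂ Z ∷ α) =
  ([] , Z , α) ∷ map (λ { (β , Y , β') → (inj₂ Z ∷ β , Y , β') }) (factorizations α)

linearize : ∀ {T : Set} {n : ℕ} → CFG n T → CFG n (Σ′ T n)
productions (linearize G) =
  concatMap (λ { (X , α) → (X , hat α)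
                 ∷ map (λ { (β , Y , β') → (X , hat β ++ inj₂ Y ∷ hat β') }) (factorizations α) })
            (productions G)

-- Evaluated at v, a monomial α is the single word α̂, and its differential in direction w
-- consists of the words obtained from α̂ by replacing one occurrence of some v_Z by a word
-- of w(Z). So (DF|_v)^j(F(v))(X) is the set of words built by j nested such replacements,
-- starting from a production of X: a spine of j productions X → β Y β' closed by a
-- production α. Every sentential form of G̃ contains at most one variable, so a derivation
-- in G̃ is exactly such a spine, read top-down.
module Submission where

open import Defs
open import Data.Nat using (ℕ; zero; suc)
open import Data.Fin using (Fin; _≟_)
open import Data.List using (List; []; _∷_; _++_; map)
open import Data.List.Properties using (++-assoc; map-++; ∷-injective; ++-identityʳ; map-injective)
open import Data.List.Membership.Propositional using (_∈_; find; lose)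
open import Data.List.Membership.Propositional.Properties using (∈-map⁺; ∈-map⁻; ∈-concatMap⁺; ∈-concatMap⁻)
open import Data.List.Relation.Unary.Any using (here; there)
open import Data.Product using (∃-syntax; _×_; _,_; proj₂)
open import Data.Sum using (_⊎_; inj₁; inj₂)
open import Data.Sum.Properties using (inj₁-injective)
open import Data.Empty using (⊥-elim)
open import Relation.Nullary using (¬_; yes; no)
open import Relation.Binary.PropositionalEquality
open import Relation.Binary.Construct.Closure.ReflexiveTransitive using (Star; ε; _◅_; gmap)
open import Function.Bundles using (_⇔_; mk⇔; Equivalence)
open import Function.Construct.Identity using (⇔-id)

module _ {A : Set} where

  ++-regroup : (xs ys us zs ws : List A) →
               xs ++ (ys ++ us ++ zs) ++ ws ≡ (xs ++ ys) ++ us ++ (zs ++ ws)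
  ++-regroup xs ys us zs ws = begin
    xs ++ (ys ++ us ++ zs) ++ ws   ≡⟨ cong (xs ++_) (++-assoc ys (us ++ zs) ws) ⟩
    xs ++ ys ++ (us ++ zs) ++ ws   ≡⟨ cong (λ l → xs ++ ys ++ l) (++-assoc us zs ws) ⟩
    xs ++ ys ++ us ++ zs ++ ws     ≡⟨ ++-assoc xs ys (us ++ zs ++ ws) ⟨
    (xs ++ ys) ++ us ++ zs ++ ws   ∎
    where open ≡-Reasoning

module _ {A B : Set} where

  map-++₃ : (f : A → B) (xs ys zs : List A) →
            map f (xs ++ ys ++ zs) ≡ map f xs ++ map f ys ++ map f zs
  map-++₃ f xs ys zs = trans (map-++ f xs (ys ++ zs)) (cong (map f xs ++_) (map-++ f ys zs))

  map-inj₁-regroup : ∀ (p β : List A) (y : B) β' s →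
                     map inj₁ p ++ (map inj₁ β ++ inj₂ y ∷ map inj₁ β') ++ map inj₁ s ≡
                     map inj₁ (p ++ β) ++ inj₂ y ∷ map inj₁ (β' ++ s)
  map-inj₁-regroup p β y β' s = begin
    map inj₁ p ++ (map inj₁ β ++ inj₂ y ∷ map inj₁ β') ++ map inj₁ s
      ≡⟨ ++-regroup (map inj₁ p) (map inj₁ β) (inj₂ y ∷ []) (map inj₁ β') (map inj₁ s) ⟩
    (map inj₁ p ++ map inj₁ β) ++ inj₂ y ∷ map inj₁ β' ++ map inj₁ s
      ≡⟨ cong₂ (λ l r → l ++ inj₂ y ∷ r) (map-++ inj₁ p β) (map-++ inj₁ β' s) ⟨
    map inj₁ (p ++ β) ++ inj₂ y ∷ map inj₁ (β' ++ s)
      ∎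
    where open ≡-Reasoning

  split≢map-inj₁ : ∀ (β : List (A ⊎ B)) z β' (x : List A) → β ++ inj₂ z ∷ β' ≢ map inj₁ x
  split≢map-inj₁ []      z β' []      ()
  split≢map-inj₁ []      z β' (_ ∷ _) ()
  split≢map-inj₁ (_ ∷ β) z β' []      ()
  split≢map-inj₁ (_ ∷ β) z β' (_ ∷ x) eq = split≢map-inj₁ β z β' x (proj₂ (∷-injective eq))

  split-map-inj₁-unique : ∀ (β : List (A ⊎ B)) z β' p y s →
                          β ++ inj₂ z ∷ β' ≡ map inj₁ p ++ inj₂ y ∷ map inj₁ s →
                          β ≡ map inj₁ p × z ≡ y × β' ≡ map inj₁ s
  split-map-inj₁-unique []      z β' []      y s refl = refl , refl , refl
  split-map-inj₁-unique []      z β' (_ ∷ p) y s ()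
  split-map-inj₁-unique (_ ∷ β) z β' []      y s eq =
    ⊥-elim (split≢map-inj₁ β z β' s (proj₂ (∷-injective eq)))
  split-map-inj₁-unique (_ ∷ β) z β' (_ ∷ p) y s eq with ∷-injective eq
  ... | refl , eq′ with split-map-inj₁-unique β z β' p y s eq′
  ... | refl , refl , refl = refl , refl , refl

module _ {A : Set} {n : ℕ} where

  DX-var⁻ : ∀ (Z Y : Fin n) (W : Valuation A n) {u : Valuation A n} {w : List A} →
            DX Z (var Y) u W w → Z ≡ Y × W Z w
  DX-var⁻ Z Y W d with Z ≟ Y
  ... | yes Z≡Y = Z≡Y , d
  ... | no _    = ⊥-elim d

  DX-var⁺ : ∀ (Z : Fin n) (W : Valuation A n) {u : Valuation A n} {w : List A} →
            W Z w → DX Z (var Z) u W w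
  DX-var⁺ Z W d with Z ≟ Z
  ... | yes _  = d
  ... | no Z≢Z = ⊥-elim (Z≢Z refl)

module _ {T : Set} {n : ℕ} (G : CFG n T) where

  Step-production : ∀ {X α} → (X , α) ∈ productions G → Step G (inj₂ X ∷ []) α
  Step-production {X} {α} α∈G =
    subst (Step G (inj₂ X ∷ [])) (++-identityʳ α) (step [] [] X α α∈G)

  Step-++ : ∀ p s {a b} → Step G a b → Step G (p ++ a ++ s) (p ++ b ++ s)
  Step-++ p s (step β β' X α α∈G) =
    subst₂ (Step G) (sym (++-regroup p β (inj₂ X ∷ []) β' s)) (sym (++-regroup p β α β' s))
      (step (p ++ β) (β' ++ s) X α α∈G)

  Star-++ : ∀ p s {a b} → Star (Step G) a b → Star (Step G) (p ++ a ++ s) (p ++ b ++ s)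
  Star-++ p s = gmap (λ a → p ++ a ++ s) (Step-++ p s)

  Step-from-terminals : ∀ t {a b} → Step G a b → a ≢ map inj₁ t
  Step-from-terminals t (step β β' X _ _) = split≢map-inj₁ β X β' t

  Star-from-terminals : ∀ t {b} → Star (Step G) (map inj₁ t) b → map inj₁ t ≡ b
  Star-from-terminals t ε       = refl
  Star-from-terminals t (s ◅ _) = ⊥-elim (Step-from-terminals t s refl)

  Step-from-split : ∀ p Y s {a b} → Step G a b → a ≡ map inj₁ p ++ inj₂ Y ∷ map inj₁ s →
                    ∃[ γ ] (Y , γ) ∈ productions G × b ≡ map inj₁ p ++ γ ++ map inj₁ s
  Step-from-split p Y s (step β β' X γ γ∈G) eq with split-map-inj₁-unique β X β' p Y s eq
  ... | refl , refl , refl = γ , γ∈G , refl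

module _ {T : Set} {n : ℕ} where

  private
    Word : Set
    Word = List (Σ′ T n)

  data ReplacedOnce (Z : Fin n) (K : Language (Σ′ T n)) : Word → Word → Set where
    replace : ∀ β β' {u} → K u → ReplacedOnce Z K (β ++ inj₂ Z ∷ β') (β ++ u ++ β')

  ReplacedOnce-map : ∀ {Z} {K K' : Language (Σ′ T n)} → (∀ {u} → K u → K' u) →
                     ∀ {α w} → ReplacedOnce Z K α w → ReplacedOnce Z K' α w
  ReplacedOnce-map f (replace β β' k) = replace β β' (f k)

  ReplacedOnce-∷ : ∀ {Z K α w} c → ReplacedOnce Z K α w → ReplacedOnce Z K (c ∷ α) (c ∷ w)
  ReplacedOnce-∷ c (replace β β' k) = replace (c ∷ β) β' k

  eval-mono-v⁻ : ∀ (α : Word) {w} → evalP (mono α) vval w → w ≡ α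
  eval-mono-v⁻ []           e = e
  eval-mono-v⁻ (inj₁ a ∷ α) (_ , _ , refl , refl , e) = cong (inj₁ a ∷_) (eval-mono-v⁻ α e)
  eval-mono-v⁻ (inj₂ Y ∷ α) (_ , _ , refl , refl , e) = cong (inj₂ Y ∷_) (eval-mono-v⁻ α e)

  eval-mono-v⁺ : ∀ (α : Word) → evalP (mono α) vval α
  eval-mono-v⁺ []           = refl
  eval-mono-v⁺ (inj₁ a ∷ α) = _ , α , refl , refl , eval-mono-v⁺ α
  eval-mono-v⁺ (inj₂ Y ∷ α) = _ , α , refl , refl , eval-mono-v⁺ α

  DX-mono-v⁻ : ∀ (α : Word) {Z : Fin n} {W : Valuation (Σ′ T n) n} {w : Word} →
               DX Z (mono α) vval W w → ReplacedOnce Z (W Z) α w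
  DX-mono-v⁻ []           ()
  DX-mono-v⁻ (inj₁ a ∷ α) (inj₁ (_ , _ , _ , () , _))
  DX-mono-v⁻ (inj₁ a ∷ α) (inj₂ (_ , _ , refl , refl , d)) = ReplacedOnce-∷ (inj₁ a) (DX-mono-v⁻ α d)
  DX-mono-v⁻ (inj₂ Y ∷ α) {Z} {W} (inj₁ (u , _ , refl , d , e))
    with DX-var⁻ Z Y W {vval} d | eval-mono-v⁻ α e
  ... | refl , wu | refl = replace [] α wu
  DX-mono-v⁻ (inj₂ Y ∷ α) (inj₂ (_ , _ , refl , refl , d)) = ReplacedOnce-∷ (inj₂ Y) (DX-mono-v⁻ α d)

  DX-mono-v⁺ : ∀ {α : Word} {Z : Fin n} {W : Valuation (Σ′ T n) n} {w : Word} →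
               ReplacedOnce Z (W Z) α w → DX Z (mono α) vval W w
  DX-mono-v⁺ {Z = Z} {W} (replace [] β' {u} wu) =
    inj₁ (u , β' , refl , DX-var⁺ Z W {vval} wu , eval-mono-v⁺ β')
  DX-mono-v⁺ {W = W} (replace (inj₁ a ∷ β) β' wu) =
    inj₂ (_ , _ , refl , refl , DX-mono-v⁺ {W = W} (replace β β' wu))
  DX-mono-v⁺ {W = W} (replace (inj₂ Y ∷ β) β' wu) =
    inj₂ (_ , _ , refl , refl , DX-mono-v⁺ {W = W} (replace β β' wu))

  module Fpoly-union (I : Poly (Σ′ T n) n → Language (Σ′ T n))
                     (I-∅ : ∀ {w} → ¬ I (const ∅L) w)
                     (I-⊕ : ∀ {p q w} → I (p ⊕ q) w ⇔ (I p w ⊎ I q w)) where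

    Fpoly⁻ : ∀ ps {X w} → I (Fpoly (record { productions = ps }) X) w →
             ∃[ α ] (X , α) ∈ ps × I (mono α) w
    Fpoly⁻ [] i = ⊥-elim (I-∅ i)
    Fpoly⁻ ((Y , α) ∷ ps) {X} i with Y ≟ X
    ... | no _ = let β , β∈ps , iβ = Fpoly⁻ ps i in β , there β∈ps , iβ
    ... | yes refl with Equivalence.to I-⊕ i
    ...   | inj₁ iα = α , here refl , iα
    ...   | inj₂ i′ = let β , β∈ps , iβ = Fpoly⁻ ps i′ in β , there β∈ps , iβ

    Fpoly⁺ : ∀ ps {X α w} → (X , α) ∈ ps → I (mono α) w →
             I (Fpoly (record { productions = ps }) X) w
    Fpoly⁺ ((Y , β) ∷ ps) {X} α∈ps iα with Y ≟ X | α∈ps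
    ... | yes _    | here refl  = Equivalence.from I-⊕ (inj₁ iα)
    ... | yes _    | there α∈ps = Equivalence.from I-⊕ (inj₂ (Fpoly⁺ ps α∈ps iα))
    ... | no  _    | there α∈ps = Fpoly⁺ ps α∈ps iα
    ... | no  Y≢X  | here refl  = ⊥-elim (Y≢X refl)

  module eval-Fpoly (u : Valuation (Σ′ T n) n) = Fpoly-union (λ p → evalP p u) (λ ()) (⇔-id _)
  module DX-Fpoly (Z : Fin n) (u W : Valuation (Σ′ T n) n) =
    Fpoly-union (λ p → DX Z p u W) (λ ()) (⇔-id _)

  ∈-factorizations⁻ : ∀ {α : Word} {β Y β'} → (β , Y , β') ∈ factorizations α →
                      α ≡ β ++ inj₂ Y ∷ β'
  ∈-factorizations⁻ {[]} ()
  ∈-factorizations⁻ {inj₁ a ∷ α} f∈ with ∈-map⁻ _ f∈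
  ... | _ , f∈′ , refl = cong (inj₁ a ∷_) (∈-factorizations⁻ f∈′)
  ∈-factorizations⁻ {inj₂ Z ∷ α} (here refl) = refl
  ∈-factorizations⁻ {inj₂ Z ∷ α} (there f∈) with ∈-map⁻ _ f∈
  ... | _ , f∈′ , refl = cong (inj₂ Z ∷_) (∈-factorizations⁻ f∈′)

  ∈-factorizations⁺ : ∀ (β : Word) Y β' → (β , Y , β') ∈ factorizations (β ++ inj₂ Y ∷ β')
  ∈-factorizations⁺ []           Y β' = here refl
  ∈-factorizations⁺ (inj₁ a ∷ β) Y β' = ∈-map⁺ _ (∈-factorizations⁺ β Y β')
  ∈-factorizations⁺ (inj₂ Z ∷ β) Y β' = there (∈-map⁺ _ (∈-factorizations⁺ β Y β'))

  data LinearProduction (G : CFG n T) : Fin n → List (Σ′ T n ⊎ Fin n) → Set where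
    terminal : ∀ {X α} → (X , α) ∈ productions G → LinearProduction G X (hat α)
    linear   : ∀ {X β Y β'} → (X , β ++ inj₂ Y ∷ β') ∈ productions G →
               LinearProduction G X (hat β ++ inj₂ Y ∷ hat β')

  module _ {G : CFG n T} where

    ∈-linearize⁻ : ∀ {X γ} → (X , γ) ∈ productions (linearize G) → LinearProduction G X γ
    ∈-linearize⁻ p∈ with find (∈-concatMap⁻ _ {xs = productions G} p∈)
    ... | (_ , α) , α∈G , here refl = terminal α∈G
    ... | (_ , α) , α∈G , there p∈′ with ∈-map⁻ _ p∈′
    ...   | (β , Y , β') , f∈ , refl with refl ← ∈-factorizations⁻ {α} f∈ = linear α∈G

    ∈-linearize⁺ : ∀ {X γ} → LinearProduction G X γ → (X , γ) ∈ productions (linearize G)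
    ∈-linearize⁺ (terminal α∈G) = ∈-concatMap⁺ _ {xs = productions G} (lose α∈G (here refl))
    ∈-linearize⁺ (linear {β = β} {Y} {β'} α∈G) =
      ∈-concatMap⁺ _ {xs = productions G}
        (lose α∈G (there (∈-map⁺ _ (∈-factorizations⁺ β Y β'))))

module _ {T : Set} {n : ℕ} (G : CFG n T) where

  -- As Σ′ T n is T ⊎ Fin n, a right-hand side α of G is also a word over Σ', with Z read as v_Z.
  data Spine : ℕ → Fin n → List (Σ′ T n) → Set where
    base   : ∀ {X α} → (X , α) ∈ productions G → Spine 0 X α
    unfold : ∀ {j X α Y w} → (X , α) ∈ productions G → ReplacedOnce Y (Spine j Y) α w →
             Spine (suc j) X w

  iter-DF⁻ : ∀ j {X w} → iter (DF G vval) j (Fval G vval) X w → Spine j X w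
  iter-DF⁻ zero i with eval-Fpoly.Fpoly⁻ vval (productions G) i
  ... | α , α∈G , e with refl ← eval-mono-v⁻ α e = base α∈G
  iter-DF⁻ (suc j) (Z , d)
    with DX-Fpoly.Fpoly⁻ Z vval (iter (DF G vval) j (Fval G vval)) (productions G) d
  ... | α , α∈G , d′ = unfold α∈G (ReplacedOnce-map (iter-DF⁻ j) (DX-mono-v⁻ α d′))

  iter-DF⁺ : ∀ {j X w} → Spine j X w → iter (DF G vval) j (Fval G vval) X w
  iter-DF⁺ (base {α = α} α∈G) = eval-Fpoly.Fpoly⁺ vval (productions G) α∈G (eval-mono-v⁺ α)
  iter-DF⁺ {suc j} (unfold {Y = Y} α∈G (replace β β' s)) =
    Y , DX-Fpoly.Fpoly⁺ Y vval (iter (DF G vval) j (Fval G vval)) (productions G) α∈G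
          (DX-mono-v⁺ (replace β β' (iter-DF⁺ s)))

  Spine⇒Star : ∀ {j X w} → Spine j X w → Star (Step (linearize G)) (inj₂ X ∷ []) (hat w)
  Spine⇒Star (base α∈G) = Step-production _ (∈-linearize⁺ (terminal α∈G)) ◅ ε
  Spine⇒Star (unfold α∈G (replace β β' {u} s)) =
    Step-production _ (∈-linearize⁺ (linear α∈G)) ◅
      subst (Star _ _) (sym (map-++₃ inj₁ β u β')) (Star-++ _ (hat β) (hat β') (Spine⇒Star s))

  Star⇒Spine : ∀ p Y s w {a} → Star (Step (linearize G)) a (hat w) →
               a ≡ hat p ++ inj₂ Y ∷ hat s →
               ∃[ j ] ∃[ u ] Spine j Y u × w ≡ p ++ u ++ s
  Star⇒Spine p Y s w ε eq = ⊥-elim (split≢map-inj₁ (hat p) Y (hat s) w (sym eq))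
  Star⇒Spine p Y s w (st ◅ rest) eq with Step-from-split _ p Y s st eq
  ... | γ , γ∈G̃ , refl with ∈-linearize⁻ γ∈G̃
  ... | terminal {α = α} α∈G =
    0 , α , base α∈G ,
    sym (map-injective inj₁-injective (Star-from-terminals _ (p ++ α ++ s) rest′))
    where
    rest′ : Star (Step (linearize G)) (hat (p ++ α ++ s)) (hat w)
    rest′ = subst (λ a → Star _ a (hat w)) (sym (map-++₃ inj₁ p α s)) rest
  ... | linear {β = β} {Y′} {β'} α∈G
    with j , u , sp , refl ← Star⇒Spine (p ++ β) Y′ (β' ++ s) w rest (map-inj₁-regroup p β Y′ β' s) =
    suc j , β ++ u ++ β' , unfold α∈G (replace β β' sp) , sym (++-regroup p β u β' s)

lemma7 : ∀ {n m : ℕ} (G : CFG n (Fin m)) (X : Fin n) (w : List (Σ′ (Fin m) n)) →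
    Lang (linearize G) X w ⇔ star (DF G vval) (Fval G vval) X w
lemma7 G X w = mk⇔
  (λ d → let j , u , sp , w≡u++[] = Star⇒Spine G [] X [] w d refl
         in j , iter-DF⁺ G (subst (Spine G j X) (sym (trans w≡u++[] (++-identityʳ u))) sp))
  (λ (j , i) → Spine⇒Star G (iter-DF⁻ G j i))
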